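{- Let $G=(V,c,M)$ be a marked symmetric graph. Let $s,t\in M$ be distinct vertices and let $C$ be a basic minimum $(s,t)$-cut of $G$. Then for every basic minimum marked cut $C'$ of $G$, at least one of the following holds: (i) $C\supseteq C'$; (ii) $C\cap C'=\emptyset$; (iii) $\{s,t\}\cap C'\neq\emptyset$.
   Context: A marked symmetric graph is $G=(V,c,M)$ where $V$ is finite, $c:V\times V\to\mathbb{Q}_{\ge0}$ satisfies $c(u,v)=c(v,u)$, and $M\subseteq V$ is the set of marked vertices. A cut is a subset $C\subseteq V$. We write $\bar C=V\setminus C$. The value of $C$ is $\sum_{u\in C,v\in\bar C}c(u,v)$. An $(s,t)$-cut is a cut with $s\in C$ and $t\notin C$. A marked cut is a cut $C$ such that both $C$ and $\bar C$ contain a marked vertex. "Minimum" means of minimum value within the respective class. For a set $\mathcal{C}$ of cuts, the basic cuts in $\mathcal{C}$ are those $C\in\mathcal{C}$ such that no $C'\in\mathcal{C}$ with $C'\neq C$ satisfies $C'\subseteq C$. Thus a basic minimum $(s,t)$-cut is a basic element of the set of minimum $(s,t)$-cuts. Likewise, a basic minimum marked cut is a basic element of the set of minimum marked cuts. -}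

module Defs where

open import Data.Nat using (ℕ)
open import Data.Fin using (Fin)
open import Data.Fin.Subset using (Subset; _∈_; _∉_; _⊆_; ∁; _∩_; ⊥; Empty)
open import Data.Fin.Subset.Properties using (_∈?_)
open import Data.Bool using (Bool; true; false)
open import Data.List using (List; allFin; map; filter; sum)
open import Data.Rational using (ℚ; 0ℚ; _+_; _≤_)
open import Data.Product using (Σ; _×_; ∃; ∃-syntax; _,_)
open import Relation.Binary.PropositionalEquality using (_≡_; _≢_)
open import Relation.Nullary using (¬_)
open import Relation.Nullary.Decidable using (¬?)

record MarkedGraph (n : ℕ) : Set where
  field
    c     : Fin n → Fin n → ℚ
    c-sym : ∀ u v → c u v ≡ c v u
    c-nonneg : ∀ u v → 0ℚ ≤ c u v
    M     : Subset n

open MarkedGraph public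

Cut : ℕ → Set
Cut n = Subset n

sumℚ : List ℚ → ℚ
sumℚ = Data.List.foldr _+_ 0ℚ

value : ∀ {n} → MarkedGraph n → Cut n → ℚ
value {n} G C =
  sumℚ (map (λ u → sumℚ (map (λ v → c G u v)
                               (filter (λ v → ¬? (v ∈? C)) (allFin n))))
            (filter (λ u → u ∈? C) (allFin n)))

IsSTCut : ∀ {n} → Fin n → Fin n → Cut n → Set
IsSTCut s t C = s ∈ C × t ∉ C

IsMarkedCut : ∀ {n} → MarkedGraph n → Cut n → Set
IsMarkedCut G C = (∃[ u ] (u ∈ C × u ∈ M G)) × (∃[ v ] (v ∉ C × v ∈ M G))

IsMinimumIn : ∀ {n} → MarkedGraph n → (Cut n → Set) → Cut n → Set
IsMinimumIn G P C = P C × (∀ D → P D → value G C ≤ value G D)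

IsBasicIn : ∀ {n} → (Cut n → Set) → Cut n → Set
IsBasicIn P C = P C × (∀ D → P D → D ⊆ C → D ≡ C)

IsBasicMinSTCut : ∀ {n} → MarkedGraph n → Fin n → Fin n → Cut n → Set
IsBasicMinSTCut G s t = IsBasicIn (IsMinimumIn G (IsSTCut s t))

IsBasicMinMarkedCut : ∀ {n} → MarkedGraph n → Cut n → Set
IsBasicMinMarkedCut G = IsBasicIn (IsMinimumIn G (IsMarkedCut G))

-- The cut function is symmetric (value (∁ X) = value X) and submodular, because each edge
-- contributes submodularly; together these give posimodularity,
-- value (A ∖ B) + value (B ∖ A) ≤ value A + value B. Suppose s, t ∉ C′ and let u ∈ C′ be marked.
-- If u ∈ C, then C ∪ C′ is an (s,t)-cut, so minimality of C and submodularity give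
-- value (C ∩ C′) ≤ value C′; as C ∩ C′ ⊆ C′ is still a marked cut, basicness of C′ forces
-- C ∩ C′ = C′. If u ∉ C, then C ∖ C′ is an (s,t)-cut and posimodularity gives
-- value (C′ ∖ C) ≤ value C′, so C′ ∖ C = C′.

module Submission where

open import Defs
open import Data.Nat using (ℕ)
open import Data.Fin using (Fin)
open import Data.Fin.Subset using (Subset; _∈_; _⊆_; _∩_; ⊥)
open import Data.Sum using (_⊎_)
open import Relation.Binary.PropositionalEquality using (_≡_; _≢_)

import Algebra.Lattice.Properties.BooleanAlgebra as BooleanAlgebraProperties
open import Data.Bool using (Bool; true; false; not; _∧_; _∨_; if_then_else_)
open import Data.Fin using (zero; suc)
open import Data.Nat using (zero; suc)
open import Data.Fin.Subset using (_∪_; ∁; _∉_)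
open import Data.Fin.Subset.Properties
  using (_∈?_; ∪-∩-booleanAlgebra; ∩-comm; Empty-unique; x∈p∩q⁺; x∈p∩q⁻; x∈p∪q⁺; x∈p∪q⁻;
         x∉p⇒x∈∁p; x∈∁p⇒x∉p)
open import Data.List using (List; []; _∷_; map; filter; allFin; tabulate)
open import Data.List.Properties using (map-tabulate)
open import Data.Product using (_,_; proj₁; proj₂)
open import Data.Sum using (inj₁; inj₂; [_,_])
open import Data.Rational using (ℚ; 0ℚ; _+_; -_; _≤_)
open import Data.Rational.Properties
  using (+-0-commutativeMonoid; +-assoc; +-comm; +-identityˡ; +-identityʳ; +-inverseʳ;
         +-mono-≤; +-monoˡ-≤; +-monoʳ-≤; ≤-refl; ≤-trans; ≤-reflexive; module ≤-Reasoning)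
open import Data.Vec using (_∷_; lookup)
open import Data.Vec.Properties using (lookup-zipWith; lookup-map)
open import Function using (_∘_; id)
open import Relation.Binary.PropositionalEquality using (refl; sym; trans; cong; cong₂; subst; _≗_; module ≡-Reasoning)
open import Relation.Nullary using (yes; no; does; ¬?)
open import Relation.Unary using (Pred; Decidable)

open import Algebra.Properties.CommutativeMonoid.Sum +-0-commutativeMonoid
  using (sum-syntax; ∑-distrib-+; ∑-comm; sum-cong-≗; sum-replicate-zero)

∑-mono-≤ : ∀ {n} {f g : Fin n → ℚ} → (∀ i → f i ≤ g i) → ∑[ i < n ] f i ≤ ∑[ i < n ] g i
∑-mono-≤ {zero}  f≤g = ≤-refl
∑-mono-≤ {suc n} f≤g = +-mono-≤ (f≤g zero) (∑-mono-≤ (f≤g ∘ suc))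

∑-+-mono-≤ : ∀ {n} {f g h k : Fin n → ℚ} → (∀ i → f i + g i ≤ h i + k i) →
             ∑[ i < n ] f i + ∑[ i < n ] g i ≤ ∑[ i < n ] h i + ∑[ i < n ] k i
∑-+-mono-≤ {n} {f} {g} {h} {k} p = begin
  ∑[ i < n ] f i + ∑[ i < n ] g i  ≡⟨ ∑-distrib-+ f g ⟨
  ∑[ i < n ] (f i + g i)           ≤⟨ ∑-mono-≤ p ⟩
  ∑[ i < n ] (h i + k i)           ≡⟨ ∑-distrib-+ h k ⟩
  ∑[ i < n ] h i + ∑[ i < n ] k i  ∎
  where open ≤-Reasoning

sumℚ-tabulate : ∀ {n} (f : Fin n → ℚ) → sumℚ (tabulate f) ≡ ∑[ i < n ] f i
sumℚ-tabulate {zero}  f = refl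
sumℚ-tabulate {suc n} f = cong (f zero +_) (sumℚ-tabulate (f ∘ suc))

sumℚ-map-filter : ∀ {A : Set} {p} {P : Pred A p} (P? : Decidable P) (f : A → ℚ) (xs : List A) →
                  sumℚ (map f (filter P? xs)) ≡ sumℚ (map (λ x → if does (P? x) then f x else 0ℚ) xs)
sumℚ-map-filter P? f []       = refl
sumℚ-map-filter P? f (x ∷ xs) with does (P? x)
... | true  = cong (f x +_) (sumℚ-map-filter P? f xs)
... | false = trans (sumℚ-map-filter P? f xs) (sym (+-identityˡ _))

sumℚ-filter-allFin : ∀ {n p} {P : Pred (Fin n) p} (P? : Decidable P) (f : Fin n → ℚ) →
                     sumℚ (map f (filter P? (allFin n))) ≡ ∑[ i < n ] (if does (P? i) then f i else 0ℚ)
sumℚ-filter-allFin {n} P? f = trans (sumℚ-map-filter P? f (allFin n))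
  (trans (cong sumℚ (map-tabulate id f?)) (sumℚ-tabulate f?))
  where
  f? : Fin n → ℚ
  f? i = if does (P? i) then f i else 0ℚ

does-∈? : ∀ {n} (x : Fin n) (p : Subset n) → does (x ∈? p) ≡ lookup p x
does-∈? zero    (true  ∷ p) = refl
does-∈? zero    (false ∷ p) = refl
does-∈? (suc x) (b     ∷ p) = does-∈? x p

crossing : Bool → Bool → ℚ → ℚ
crossing true false x = x
crossing _    _     _ = 0ℚ

crossingSum : ∀ {n} → MarkedGraph n → (Fin n → Bool) → ℚ
crossingSum {n} G χ = ∑[ u < n ] ∑[ v < n ] crossing (χ u) (χ v) (c G u v)

crossingSum-cong : ∀ {n} (G : MarkedGraph n) {χ ψ : Fin n → Bool} → χ ≗ ψ →
                   crossingSum G χ ≡ crossingSum G ψ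
crossingSum-cong G χ≗ψ = sum-cong-≗ λ u → sum-cong-≗ λ v →
  cong₂ (λ a b → crossing a b (c G u v)) (χ≗ψ u) (χ≗ψ v)

value≡crossingSum : ∀ {n} (G : MarkedGraph n) (X : Cut n) → value G X ≡ crossingSum G (lookup X)
value≡crossingSum {n} G X = begin
  value G X
    ≡⟨ sumℚ-filter-allFin (_∈? X) _ ⟩
  ∑[ u < n ] (if does (u ∈? X) then sumℚ (map (c G u) (filter (λ v → ¬? (v ∈? X)) (allFin n))) else 0ℚ)
    ≡⟨ sum-cong-≗ (λ u → cong (λ s → if does (u ∈? X) then s else 0ℚ)
                               (sumℚ-filter-allFin (λ v → ¬? (v ∈? X)) (c G u))) ⟩
  ∑[ u < n ] (if does (u ∈? X) then ∑[ v < n ] (if not (does (v ∈? X)) then c G u v else 0ℚ) else 0ℚ)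
    ≡⟨ sum-cong-≗ (λ u → crossing-row (does (u ∈? X)) (c G u)) ⟩
  crossingSum G (λ u → does (u ∈? X))
    ≡⟨ crossingSum-cong G (λ u → does-∈? u X) ⟩
  crossingSum G (lookup X) ∎
  where
  open ≡-Reasoning
  crossing-row : ∀ a (x : Fin n → ℚ) →
    (if a then ∑[ v < n ] (if not (does (v ∈? X)) then x v else 0ℚ) else 0ℚ)
      ≡ ∑[ v < n ] crossing a (does (v ∈? X)) (x v)
  crossing-row false x = sym (sum-replicate-zero n)
  crossing-row true  x = sum-cong-≗ λ v → entry (does (v ∈? X)) (x v)
    where
    entry : ∀ b y → (if not b then y else 0ℚ) ≡ crossing true b y
    entry true  y = refl
    entry false y = refl

crossing-submodular : ∀ a₁ b₁ a₂ b₂ {x} → 0ℚ ≤ x →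
  crossing (a₁ ∧ b₁) (a₂ ∧ b₂) x + crossing (a₁ ∨ b₁) (a₂ ∨ b₂) x ≤ crossing a₁ a₂ x + crossing b₁ b₂ x
crossing-submodular true  true  true  true  _     = ≤-refl
crossing-submodular true  true  true  false {x} _ = ≤-reflexive (+-comm x 0ℚ)
crossing-submodular true  true  false true  _     = ≤-refl
crossing-submodular true  true  false false _     = ≤-refl
crossing-submodular true  false true  true  _     = ≤-refl
crossing-submodular true  false true  false _     = ≤-refl
crossing-submodular true  false false true  0≤x   = +-monoˡ-≤ 0ℚ 0≤x
crossing-submodular true  false false false {x} _ = ≤-reflexive (+-comm 0ℚ x)
crossing-submodular false true  true  true  _     = ≤-refl
crossing-submodular false true  true  false 0≤x   = +-monoʳ-≤ 0ℚ 0≤x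
crossing-submodular false true  false true  _     = ≤-refl
crossing-submodular false true  false false _     = ≤-refl
crossing-submodular false false _     _     _     = ≤-refl

crossing-not : ∀ a b x → crossing (not a) (not b) x ≡ crossing b a x
crossing-not true  true  x = refl
crossing-not true  false x = refl
crossing-not false true  x = refl
crossing-not false false x = refl

crossingSum-submodular : ∀ {n} (G : MarkedGraph n) (χ ψ : Fin n → Bool) →
  crossingSum G (λ u → χ u ∧ ψ u) + crossingSum G (λ u → χ u ∨ ψ u) ≤ crossingSum G χ + crossingSum G ψ
crossingSum-submodular G χ ψ = ∑-+-mono-≤ λ u → ∑-+-mono-≤ λ v →
  crossing-submodular (χ u) (ψ u) (χ v) (ψ v) (c-nonneg G u v)

crossingSum-not : ∀ {n} (G : MarkedGraph n) (χ : Fin n → Bool) → crossingSum G (not ∘ χ) ≡ crossingSum G χ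
crossingSum-not G χ = trans
  (sum-cong-≗ λ u → sum-cong-≗ λ v →
     trans (crossing-not (χ u) (χ v) (c G u v)) (cong (crossing (χ v) (χ u)) (c-sym G u v)))
  (∑-comm λ u v → crossing (χ v) (χ u) (c G v u))

value-submodular : ∀ {n} (G : MarkedGraph n) (A B : Cut n) →
  value G (A ∩ B) + value G (A ∪ B) ≤ value G A + value G B
value-submodular G A B = begin
  value G (A ∩ B) + value G (A ∪ B)
    ≡⟨ cong₂ _+_ (value≡crossingSum G (A ∩ B)) (value≡crossingSum G (A ∪ B)) ⟩
  crossingSum G (lookup (A ∩ B)) + crossingSum G (lookup (A ∪ B))
    ≡⟨ cong₂ _+_ (crossingSum-cong G λ u → lookup-zipWith _∧_ u A B)
                 (crossingSum-cong G λ u → lookup-zipWith _∨_ u A B) ⟩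
  crossingSum G (λ u → lookup A u ∧ lookup B u) + crossingSum G (λ u → lookup A u ∨ lookup B u)
    ≤⟨ crossingSum-submodular G (lookup A) (lookup B) ⟩
  crossingSum G (lookup A) + crossingSum G (lookup B)
    ≡⟨ cong₂ _+_ (value≡crossingSum G A) (value≡crossingSum G B) ⟨
  value G A + value G B ∎
  where open ≤-Reasoning

value-∁ : ∀ {n} (G : MarkedGraph n) (X : Cut n) → value G (∁ X) ≡ value G X
value-∁ G X = begin
  value G (∁ X)                 ≡⟨ value≡crossingSum G (∁ X) ⟩
  crossingSum G (lookup (∁ X))  ≡⟨ crossingSum-cong G (λ u → lookup-map u not X) ⟩
  crossingSum G (not ∘ lookup X) ≡⟨ crossingSum-not G (lookup X) ⟩
  crossingSum G (lookup X)      ≡⟨ value≡crossingSum G X ⟨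
  value G X ∎
  where open ≡-Reasoning

module SubsetBooleanAlgebra {n} = BooleanAlgebraProperties (∪-∩-booleanAlgebra n)

∁[p∪∁q]≡q∩∁p : ∀ {n} (p q : Subset n) → ∁ (p ∪ ∁ q) ≡ q ∩ ∁ p
∁[p∪∁q]≡q∩∁p p q = begin
  ∁ (p ∪ ∁ q)    ≡⟨ SubsetBooleanAlgebra.deMorgan₂ p (∁ q) ⟩
  ∁ p ∩ ∁ (∁ q)  ≡⟨ cong (∁ p ∩_) (SubsetBooleanAlgebra.¬-involutive q) ⟩
  ∁ p ∩ q        ≡⟨ ∩-comm (∁ p) q ⟩
  q ∩ ∁ p        ∎
  where open ≡-Reasoning

value-posimodular : ∀ {n} (G : MarkedGraph n) (A B : Cut n) →
  value G (A ∩ ∁ B) + value G (B ∩ ∁ A) ≤ value G A + value G B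
value-posimodular G A B = begin
  value G (A ∩ ∁ B) + value G (B ∩ ∁ A)
    ≡⟨ cong (λ Y → value G (A ∩ ∁ B) + value G Y) (∁[p∪∁q]≡q∩∁p A B) ⟨
  value G (A ∩ ∁ B) + value G (∁ (A ∪ ∁ B))
    ≡⟨ cong (value G (A ∩ ∁ B) +_) (value-∁ G (A ∪ ∁ B)) ⟩
  value G (A ∩ ∁ B) + value G (A ∪ ∁ B)
    ≤⟨ value-submodular G A (∁ B) ⟩
  value G A + value G (∁ B)
    ≡⟨ cong (value G A +_) (value-∁ G B) ⟩
  value G A + value G B ∎
  where open ≤-Reasoning

+-cancelʳ-≤ : ∀ p q r → p + r ≤ q + r → p ≤ q
+-cancelʳ-≤ p q r p+r≤q+r = begin
  p             ≡⟨ +-identityʳ p ⟨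
  p + 0ℚ        ≡⟨ cong (p +_) (+-inverseʳ r) ⟨
  p + (r + - r) ≡⟨ +-assoc p r (- r) ⟨
  p + r + - r   ≤⟨ +-monoˡ-≤ (- r) p+r≤q+r ⟩
  q + r + - r   ≡⟨ +-assoc q r (- r) ⟩
  q + (r + - r) ≡⟨ cong (q +_) (+-inverseʳ r) ⟩
  q + 0ℚ        ≡⟨ +-identityʳ q ⟩
  q             ∎
  where open ≤-Reasoning

p+q≤r+s⇒r≤q⇒p≤s : ∀ {p q r s} → p + q ≤ r + s → r ≤ q → p ≤ s
p+q≤r+s⇒r≤q⇒p≤s {p} {q} {r} {s} p+q≤r+s r≤q = +-cancelʳ-≤ p s r (begin
  p + r  ≤⟨ +-monoʳ-≤ p r≤q ⟩
  p + q  ≤⟨ p+q≤r+s ⟩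
  r + s  ≡⟨ +-comm r s ⟩
  s + r  ∎)
  where open ≤-Reasoning

module _ {n} (G : MarkedGraph n) (s t : Fin n) {C : Cut n} (minC : IsMinimumIn G (IsSTCut s t) C) where

  minSTCut-∩-≤ : ∀ {X} → t ∉ X → value G (C ∩ X) ≤ value G X
  minSTCut-∩-≤ {X} t∉X = p+q≤r+s⇒r≤q⇒p≤s (value-submodular G C X) (proj₂ minC (C ∪ X) C∪X-isSTCut)
    where
    C∪X-isSTCut : IsSTCut s t (C ∪ X)
    C∪X-isSTCut = x∈p∪q⁺ (inj₁ (proj₁ (proj₁ minC))) , [ proj₂ (proj₁ minC) , t∉X ] ∘ x∈p∪q⁻ C X

  minSTCut-∖-≤ : ∀ {X} → s ∉ X → value G (X ∩ ∁ C) ≤ value G X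
  minSTCut-∖-≤ {X} s∉X = p+q≤r+s⇒r≤q⇒p≤s
    (subst (_≤ value G C + value G X) (+-comm (value G (C ∩ ∁ X)) _) (value-posimodular G C X))
    (proj₂ minC (C ∩ ∁ X) C∖X-isSTCut)
    where
    C∖X-isSTCut : IsSTCut s t (C ∩ ∁ X)
    C∖X-isSTCut = x∈p∩q⁺ (proj₁ (proj₁ minC) , x∉p⇒x∈∁p s∉X) , proj₂ (proj₁ minC) ∘ proj₁ ∘ x∈p∩q⁻ C (∁ X)

basicMinimum-⊆-≤⇒≡ : ∀ {n} (G : MarkedGraph n) (P : Cut n → Set) {C D : Cut n} →
  IsBasicIn (IsMinimumIn G P) C → P D → D ⊆ C → value G D ≤ value G C → D ≡ C
basicMinimum-⊆-≤⇒≡ G P ((_ , minC) , basicC) PD D⊆C D≤C =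
  basicC _ (PD , λ E PE → ≤-trans D≤C (minC E PE)) D⊆C

isMarkedCut-⊆ : ∀ {n} (G : MarkedGraph n) {X D : Cut n} {u} →
  IsMarkedCut G X → D ⊆ X → u ∈ D → u ∈ M G → IsMarkedCut G D
isMarkedCut-⊆ G (_ , (v , v∉X , v∈M)) D⊆X u∈D u∈M = (_ , u∈D , u∈M) , (v , v∉X ∘ D⊆X , v∈M)

module _ {n} (G : MarkedGraph n) (s t : Fin n) {C C′ : Cut n}
         (minC : IsMinimumIn G (IsSTCut s t) C) (basicC′ : IsBasicMinMarkedCut G C′)
         {u : Fin n} (u∈C′ : u ∈ C′) (u∈M : u ∈ M G) where

  private
    markedC′ : IsMarkedCut G C′
    markedC′ = proj₁ (proj₁ basicC′)

  basicMinMarkedCut-⊆ : t ∉ C′ → u ∈ C → C′ ⊆ C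
  basicMinMarkedCut-⊆ t∉C′ u∈C x∈C′ = proj₁ (x∈p∩q⁻ C C′ (subst (_ ∈_) (sym C∩C′≡C′) x∈C′))
    where
    C∩C′≡C′ : C ∩ C′ ≡ C′
    C∩C′≡C′ = basicMinimum-⊆-≤⇒≡ G (IsMarkedCut G) basicC′
      (isMarkedCut-⊆ G markedC′ (proj₂ ∘ x∈p∩q⁻ C C′) (x∈p∩q⁺ (u∈C , u∈C′)) u∈M)
      (proj₂ ∘ x∈p∩q⁻ C C′) (minSTCut-∩-≤ G s t minC t∉C′)

  basicMinMarkedCut-disjoint : s ∉ C′ → u ∉ C → C ∩ C′ ≡ ⊥
  basicMinMarkedCut-disjoint s∉C′ u∉C = Empty-unique λ where
      (x , x∈C∩C′) → let (x∈C , x∈C′) = x∈p∩q⁻ C C′ x∈C∩C′ in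
        x∈∁p⇒x∉p (proj₂ (x∈p∩q⁻ C′ (∁ C) (subst (x ∈_) (sym C′∖C≡C′) x∈C′))) x∈C
    where
    C′∖C≡C′ : C′ ∩ ∁ C ≡ C′
    C′∖C≡C′ = basicMinimum-⊆-≤⇒≡ G (IsMarkedCut G) basicC′
      (isMarkedCut-⊆ G markedC′ (proj₁ ∘ x∈p∩q⁻ C′ (∁ C)) (x∈p∩q⁺ (u∈C′ , x∉p⇒x∈∁p u∉C)) u∈M)
      (proj₁ ∘ x∈p∩q⁻ C′ (∁ C)) (minSTCut-∖-≤ G s t minC s∉C′)

mainTheorem6 : ∀ {n} (G : MarkedGraph n) (s t : Fin n) →
    s ∈ M G → t ∈ M G → s ≢ t →
    (C : Cut n) → IsBasicMinSTCut G s t C →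
    (C′ : Cut n) → IsBasicMinMarkedCut G C′ →
    (C′ ⊆ C) ⊎ (C ∩ C′ ≡ ⊥) ⊎ (s ∈ C′ ⊎ t ∈ C′)
mainTheorem6 G s t _ _ _ C (minC , _) C′ basicC′ with s ∈? C′ | t ∈? C′
... | yes s∈C′ | _        = inj₂ (inj₂ (inj₁ s∈C′))
... | no _     | yes t∈C′ = inj₂ (inj₂ (inj₂ t∈C′))
... | no s∉C′  | no t∉C′  with proj₁ (proj₁ (proj₁ basicC′))
...   | u , u∈C′ , u∈M with u ∈? C
...     | yes u∈C = inj₁ (basicMinMarkedCut-⊆ G s t minC basicC′ u∈C′ u∈M t∉C′ u∈C)
...     | no u∉C  = inj₂ (inj₁ (basicMinMarkedCut-disjoint G s t minC basicC′ u∈C′ u∈M s∉C′ u∉C))
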